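{- For any $m$-colored combinatorial Hopf algebra $(\mathcal{H},\dot{\varphi})$, $\dot\varphi=(\varphi^{(0)},\ldots,\varphi^{(m-1)})$, there is a unique morphism of $m$-colored combinatorial Hopf algebras $\Psi:(\mathcal{H},\dot{\varphi})\to(\mathcal{Q}sym^{(m)},\dot{\zeta}_{\mathcal{Q}})$. It is given explicitly by \[\Psi(h) = \sum_{ \alpha \models_m n} \varphi_{\alpha}(h)M^{(m)}_{\alpha}\qquad (h\in\mathcal{H}_n),\] where for $\alpha = (\omega^{j_1}\alpha_1, \ldots, \omega^{j_k}\alpha_k)$, $\varphi_{\alpha}$ is the composite \[\mathcal{H} \xrightarrow{\Delta^{(k-1)}} \mathcal{H}^{\otimes k} \twoheadrightarrow \mathcal{H}_{\alpha_1} \otimes \cdots \otimes \mathcal{H}_{\alpha_k} \xrightarrow{\mathsf{m} \circ (\varphi^{(j_1)} \otimes \cdots \otimes \varphi^{(j_k)})} \mathbb{Q},\] with $\Delta^{(k-1)}$ the $(k-1)$-fold iterated coproduct, the middle map the canonical projection, and $\mathsf{m}$ multiplication in $\mathbb{Q}$.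
   Context: All Hopf algebras are graded connected Hopf algebras $\mathcal{H}=\bigoplus_{n\ge0}\mathcal{H}_n$ over $\mathbb{Q}$ ($\mathcal{H}_0$ spanned by the unit). A character is an algebra homomorphism $\mathcal{H}\to\mathbb{Q}$. An $m$-colored combinatorial Hopf algebra is a pair $(\mathcal{H},\dot\varphi)$ with $\dot\varphi=(\varphi^{(0)},\ldots,\varphi^{(m-1)})$ an ordered $m$-tuple of characters of $\mathcal{H}$. A morphism $(\mathcal{H},\dot\varphi)\to(\mathcal{H}',\dot\varphi')$ is a Hopf algebra homomorphism $\psi:\mathcal{H}\to\mathcal{H}'$ with $\varphi^{(j)}=(\varphi^{(j)})'\circ\psi$ for every $j$. Let $\omega$ be a primitive $m$th root of unity. An $m$-colored composition of $n$ ($\alpha\models_mn$) is $\alpha=(\omega^{j_1}\alpha_1,\ldots,\omega^{j_k}\alpha_k)$ with positive integers $\alpha_i$ summing to $n$ and $j_i\in\{0,\ldots,m-1\}$. In commuting variables $x_{i,j}$ ($i\ge1$, $0\le j\le m-1$), $M^{(m)}_\alpha=\sum x_{i_1,j_1}^{\alpha_1}\cdots x_{i_k,j_k}^{\alpha_k}$ over $i_1,\ldots,i_k$ with $(i_1,j_1)<\cdots<(i_k,j_k)$ lexicographically. $\mathcal{Q}sym^{(m)}$ is the span of all $M^{(m)}_\alpha$ (graded by $n$), a graded connected Hopf algebra with the usual product of power series, counit the constant term, coproduct $\Delta_m(M^{(m)}_\alpha)=\sum_{\beta\gamma=\alpha}M^{(m)}_\beta\otimes M^{(m)}_\gamma$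 (concatenations). $\zeta^{(j)}_{\mathcal{Q}}:\mathcal{Q}sym^{(m)}\to\mathbb{Q}$ is the character given by substituting $x_{1,j}=1$ and all other variables $=0$; $\dot\zeta_{\mathcal{Q}}=(\zeta^{(0)}_{\mathcal{Q}},\ldots,\zeta^{(m-1)}_{\mathcal{Q}})$. -}

module Defs where

open import Level using (Level; _⊔_) renaming (suc to lsuc)
open import Data.Nat as ℕ using (ℕ; zero; suc; _∸_; _≟_)
open import Data.Fin as Fin using (Fin)
open import Data.List using (List; []; _∷_; _++_; map; concatMap; foldr; upTo; length)
open import Data.Vec using (Vec; lookup; _[_]≔_) renaming ([] to []ᵥ; _∷_ to _∷ᵥ_)
open import Data.Product using (Σ; ∃; _×_; _,_; proj₁; proj₂)
open import Data.Rational using (ℚ; 0ℚ; 1ℚ; _+_; _*_)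
open import Data.Rational.Properties using (+-*-commutativeRing)
open import Algebra.Module.Bundles using (Module)
open import Relation.Binary.PropositionalEquality using (_≡_; _≢_)
open import Relation.Nullary using (does)
open import Data.Bool using (if_then_else_)

ℚRing = +-*-commutativeRing

sumℚ : List ℚ → ℚ
sumℚ = foldr _+_ 0ℚ

-- Elements of the
-- tensor power H^{⊗k} are represented by formal finite sums
-- Σ q · (v₀ ⊗ ⋯ ⊗ v_{k-1}), i.e. lists of pairs (q , v) with v : Vec H k;
-- two such formal sums are identified (_≈T_) iff every k-multilinear
-- form H^k → ℚ takes the same value on them (over a field this is
-- exactly equality in H^{⊗k}).

module _ {c ℓ : Level} (V : Module ℚRing c ℓ) where
  open Module V

  Tensor : ℕ → Set c
  Tensor k = List (ℚ × Vec Carrierᴹ k)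

  record MultiLinear (k : ℕ) (B : Vec Carrierᴹ k → ℚ) : Set (c ⊔ ℓ) where
    field
      cong  : ∀ (v w : Vec Carrierᴹ k) → (∀ i → lookup v i ≈ᴹ lookup w i) → B v ≡ B w
      addᵢ  : ∀ (i : Fin k) v x y → B (v [ i ]≔ (x +ᴹ y)) ≡ B (v [ i ]≔ x) + B (v [ i ]≔ y)
      homᵢ  : ∀ (i : Fin k) v (r : ℚ) x → B (v [ i ]≔ (r *ₗ x)) ≡ r * B (v [ i ]≔ x)

  evalT : ∀ {k} → (Vec Carrierᴹ k → ℚ) → Tensor k → ℚ
  evalT B t = sumℚ (map (λ p → proj₁ p * B (proj₂ p)) t)

  _≈T_ : ∀ {k} → Tensor k → Tensor k → Set (c ⊔ ℓ)
  _≈T_ {k} t u = ∀ (B : Vec Carrierᴹ k → ℚ) → MultiLinear k B → evalT B t ≡ evalT B u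

  scaleT : ∀ {k} → ℚ → Tensor k → Tensor k
  scaleT r = map (λ p → (r * proj₁ p , proj₂ p))

  sumᴹ : List (ℚ × Carrierᴹ) → Carrierᴹ
  sumᴹ = foldr (λ p acc → proj₁ p *ₗ proj₂ p +ᴹ acc) 0ᴹ

  sumH : List Carrierᴹ → Carrierᴹ
  sumH = foldr _+ᴹ_ 0ᴹ

v2 : ∀ {a} {A : Set a} → A → A → Vec A 2
v2 x y = x ∷ᵥ (y ∷ᵥ []ᵥ)

v3 : ∀ {a} {A : Set a} → A → A → A → Vec A 3
v3 x y z = x ∷ᵥ (y ∷ᵥ (z ∷ᵥ []ᵥ))

record GCHopf (c ℓ : Level) : Set (lsuc (c ⊔ ℓ)) where
  field
    V : Module ℚRing c ℓ
  open Module V public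
  H : Set c
  H = Carrierᴹ
  field
    _·_   : H → H → H
    𝟙     : H
    ·-cong : ∀ {x x' y y'} → x ≈ᴹ x' → y ≈ᴹ y' → (x · y) ≈ᴹ (x' · y')
    ·-distribʳ : ∀ x y z → ((x +ᴹ y) · z) ≈ᴹ ((x · z) +ᴹ (y · z))
    ·-distribˡ : ∀ x y z → (x · (y +ᴹ z)) ≈ᴹ ((x · y) +ᴹ (x · z))
    ·-scaleˡ  : ∀ r x y → ((r *ₗ x) · y) ≈ᴹ (r *ₗ (x · y))
    ·-scaleʳ  : ∀ r x y → (x · (r *ₗ y)) ≈ᴹ (r *ₗ (x · y))
    ·-assoc   : ∀ x y z → ((x · y) · z) ≈ᴹ (x · (y · z))
    ·-identityˡ : ∀ x → (𝟙 · x) ≈ᴹ x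
    ·-identityʳ : ∀ x → (x · 𝟙) ≈ᴹ x
    Δ     : H → Tensor V 2
    ε     : H → ℚ
    Δ-cong : ∀ {x y} → x ≈ᴹ y → _≈T_ V (Δ x) (Δ y)
    Δ-add  : ∀ x y → _≈T_ V (Δ (x +ᴹ y)) (Δ x ++ Δ y)
    Δ-scale : ∀ r x → _≈T_ V (Δ (r *ₗ x)) (scaleT V r (Δ x))
    ε-cong : ∀ {x y} → x ≈ᴹ y → ε x ≡ ε y
    ε-add  : ∀ x y → ε (x +ᴹ y) ≡ ε x + ε y
    ε-scale : ∀ r x → ε (r *ₗ x) ≡ r * ε x
    -- coassociativity (Δ ⊗ id) ∘ Δ = (id ⊗ Δ) ∘ Δ
    Δ-coassoc : ∀ h → _≈T_ V
      (concatMap (λ p → map (λ p' → (proj₁ p * proj₁ p' ,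
            v3 (lookup (proj₂ p') Fin.zero) (lookup (proj₂ p') (Fin.suc Fin.zero)) (lookup (proj₂ p) (Fin.suc Fin.zero))))
          (Δ (lookup (proj₂ p) Fin.zero))) (Δ h))
      (concatMap (λ p → map (λ p' → (proj₁ p * proj₁ p' ,
            v3 (lookup (proj₂ p) Fin.zero) (lookup (proj₂ p') Fin.zero) (lookup (proj₂ p') (Fin.suc Fin.zero))))
          (Δ (lookup (proj₂ p) (Fin.suc Fin.zero)))) (Δ h))
    -- counit: (ε ⊗ id) ∘ Δ = id = (id ⊗ ε) ∘ Δ
    ε-counitˡ : ∀ h → sumᴹ V (map (λ p → (proj₁ p * ε (lookup (proj₂ p) Fin.zero) , lookup (proj₂ p) (Fin.suc Fin.zero))) (Δ h)) ≈ᴹ h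
    ε-counitʳ : ∀ h → sumᴹ V (map (λ p → (proj₁ p * ε (lookup (proj₂ p) (Fin.suc Fin.zero)) , lookup (proj₂ p) Fin.zero)) (Δ h)) ≈ᴹ h
    -- bialgebra compatibility: Δ and ε are algebra maps
    Δ-mult : ∀ x y → _≈T_ V (Δ (x · y))
      (concatMap (λ p → map (λ p' → (proj₁ p * proj₁ p' ,
            v2 (lookup (proj₂ p) Fin.zero · lookup (proj₂ p') Fin.zero) (lookup (proj₂ p) (Fin.suc Fin.zero) · lookup (proj₂ p') (Fin.suc Fin.zero))))
          (Δ y)) (Δ x))
    Δ-unit : _≈T_ V (Δ 𝟙) ((1ℚ , v2 𝟙 𝟙) ∷ [])
    ε-mult : ∀ x y → ε (x · y) ≡ ε x * ε y
    ε-unit : ε 𝟙 ≡ 1ℚ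
    -- antipode: m ∘ (S ⊗ id) ∘ Δ = η ∘ ε = m ∘ (id ⊗ S) ∘ Δ
    S : H → H
    S-cong : ∀ {x y} → x ≈ᴹ y → S x ≈ᴹ S y
    S-add : ∀ x y → S (x +ᴹ y) ≈ᴹ (S x +ᴹ S y)
    S-scale : ∀ r x → S (r *ₗ x) ≈ᴹ (r *ₗ S x)
    S-antipodeˡ : ∀ h → sumᴹ V (map (λ p → (proj₁ p , S (lookup (proj₂ p) Fin.zero) · lookup (proj₂ p) (Fin.suc Fin.zero))) (Δ h)) ≈ᴹ (ε h *ₗ 𝟙)
    S-antipodeʳ : ∀ h → sumᴹ V (map (λ p → (proj₁ p , lookup (proj₂ p) Fin.zero · S (lookup (proj₂ p) (Fin.suc Fin.zero)))) (Δ h)) ≈ᴹ (ε h *ₗ 𝟙)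
    -- grading H = ⊕ₙ Hₙ, via projections π n : H → Hₙ
    π : ℕ → H → H
    π-cong : ∀ n {x y} → x ≈ᴹ y → π n x ≈ᴹ π n y
    π-add : ∀ n x y → π n (x +ᴹ y) ≈ᴹ (π n x +ᴹ π n y)
    π-scale : ∀ n r x → π n (r *ₗ x) ≈ᴹ (r *ₗ π n x)
    π-idem : ∀ n x → π n (π n x) ≈ᴹ π n x
    π-orth : ∀ m n x → m ≢ n → π m (π n x) ≈ᴹ 0ᴹ
    π-decomp : ∀ x → ∃ λ N → x ≈ᴹ sumH V (map (λ n → π n x) (upTo N))
    ·-graded : ∀ i j x y → π (i ℕ.+ j) (π i x · π j y) ≈ᴹ (π i x · π j y)
    𝟙-graded : π 0 𝟙 ≈ᴹ 𝟙
    -- graded coalgebra: Δ(Hₙ) ⊆ ⊕_{i+j=n} Hᵢ ⊗ Hⱼ, ε vanishes on Hₙ for n ≥ 1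
    Δ-graded : ∀ n x → _≈T_ V (Δ (π n x))
      (concatMap (λ i → map (λ p → (proj₁ p , v2 (π i (lookup (proj₂ p) Fin.zero)) (π (n ∸ i) (lookup (proj₂ p) (Fin.suc Fin.zero)))))
        (Δ (π n x))) (upTo (suc n)))
    ε-graded : ∀ n x → ε (π (suc n) x) ≡ 0ℚ
    connected : ∀ x → π 0 x ≈ᴹ (ε (π 0 x) *ₗ 𝟙)

record Character {c ℓ} (𝓗 : GCHopf c ℓ) : Set (c ⊔ ℓ) where
  open GCHopf 𝓗
  field
    ch       : H → ℚ
    ch-cong  : ∀ {x y} → x ≈ᴹ y → ch x ≡ ch y
    ch-add   : ∀ x y → ch (x +ᴹ y) ≡ ch x + ch y
    ch-scale : ∀ r x → ch (r *ₗ x) ≡ r * ch x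
    ch-mult  : ∀ x y → ch (x · y) ≡ ch x * ch y
    ch-unit  : ch 𝟙 ≡ 1ℚ

-- A part (j , a) stands for ω^j (a + 1): colour j : Fin m, size a + 1.
-- An element of 𝒬sym^(m) is recorded by its coefficient function
-- α ↦ (coefficient of M^(m)_α), i.e. f = Σ_α f(α) M^(m)_α.

CComp : ℕ → Set
CComp m = List (Fin m × ℕ)

size : ∀ {m} → CComp m → ℕ
size [] = 0
size ((j , a) ∷ α) = suc a ℕ.+ size α

Qsym : ℕ → Set
Qsym m = CComp m → ℚ

-- ways to write a part of size a+1 as (b+1) + (c+1)
splits : ℕ → List (ℕ × ℕ)
splits zero = []
splits (suc a) = map (λ b → (b , a ∸ b)) (upTo (suc a))

-- all pairs (α , β) together with one way γ arises as a quasi-shuffle of α and β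
-- (parts may merge only when they carry the same colour, i.e. the same variable x_{i,j})
unqsh : ∀ {m} → CComp m → List (CComp m × CComp m)
unqsh [] = ([] , []) ∷ []
unqsh ((j , a) ∷ γ) = concatMap (λ p →
      ((j , a) ∷ proj₁ p , proj₂ p)
    ∷ (proj₁ p , (j , a) ∷ proj₂ p)
    ∷ map (λ s → ((j , proj₁ s) ∷ proj₁ p , (j , proj₂ s) ∷ proj₂ p)) (splits a))
  (unqsh γ)

-- product of power series, expanded in the M-basis:
-- M_α M_β = Σ_γ #{quasi-shuffles of α, β giving γ} M_γ
_⋆_ : ∀ {m} → Qsym m → Qsym m → Qsym m
(f ⋆ g) γ = sumℚ (map (λ p → f (proj₁ p) * g (proj₂ p)) (unqsh γ))

𝟙Q : ∀ {m} → Qsym m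
𝟙Q [] = 1ℚ
𝟙Q (_ ∷ _) = 0ℚ

-- ζ^(j) on a homogeneous element of degree n:
-- substituting x_{1,j} = 1, all other variables 0, kills every M_α except
-- M_() (degree 0) and M_(ω^j n) (degree n ≥ 1), which become 1.
ζ : ∀ {m} → Fin m → ℕ → Qsym m → ℚ
ζ j zero f = f []
ζ j (suc k) f = f ((j , k) ∷ [])

record Morphism {c ℓ} (m : ℕ) (𝓗 : GCHopf c ℓ) (φ : Fin m → Character 𝓗) : Set (c ⊔ ℓ) where
  open GCHopf 𝓗
  field
    Ψ : H → Qsym m
    Ψ-cong  : ∀ {x y} → x ≈ᴹ y → ∀ α → Ψ x α ≡ Ψ y α
    Ψ-add   : ∀ x y α → Ψ (x +ᴹ y) α ≡ Ψ x α + Ψ y α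
    Ψ-scale : ∀ r x α → Ψ (r *ₗ x) α ≡ r * Ψ x α
    Ψ-graded : ∀ n x α → size α ≢ n → Ψ (π n x) α ≡ 0ℚ
    Ψ-mult  : ∀ x y α → Ψ (x · y) α ≡ (Ψ x ⋆ Ψ y) α
    Ψ-unit  : ∀ α → Ψ 𝟙 α ≡ 𝟙Q α
    -- coalgebra map: (Ψ ⊗ Ψ)(Δ h) = Δ_m(Ψ h), compared on the basis M_β ⊗ M_γ
    Ψ-comult : ∀ h β γ →
      sumℚ (map (λ p → proj₁ p * (Ψ (lookup (proj₂ p) Fin.zero) β * Ψ (lookup (proj₂ p) (Fin.suc Fin.zero)) γ)) (Δ h))
        ≡ Ψ h (β ++ γ)
    Ψ-counit : ∀ h → Ψ h [] ≡ ε h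
    Ψ-char : ∀ j n x → Character.ch (φ j) (π n x) ≡ ζ j n (Ψ (π n x))

module _ {c ℓ} {m : ℕ} (𝓗 : GCHopf c ℓ) (φ : Fin m → Character 𝓗) where
  open GCHopf 𝓗

  iterΔ : (k : ℕ) → H → Tensor V (suc k)
  iterΔ zero h = (1ℚ , h ∷ᵥ []ᵥ) ∷ []
  iterΔ (suc k) h = concatMap (λ p →
      map (λ p' → (proj₁ p * proj₁ p' , lookup (proj₂ p) Fin.zero ∷ᵥ proj₂ p'))
          (iterΔ k (lookup (proj₂ p) (Fin.suc Fin.zero))))
    (Δ h)

  prodΦ : (α : CComp m) → Vec H (length α) → ℚ
  prodΦ [] []ᵥ = 1ℚ
  prodΦ ((j , a) ∷ α) (x ∷ᵥ xs) = Character.ch (φ j) (π (suc a) x) * prodΦ α xs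

  -- φ_α ; for the empty composition (k = 0) Δ^(-1) is the counit ε
  φ_ : CComp m → H → ℚ
  φ_ [] h = ε h
  φ_ (p ∷ α) h = sumℚ (map (λ q → proj₁ q * prodΦ (p ∷ α) (proj₂ q)) (iterΔ (length α) h))

  -- coefficient of M_α in Σ_{α ⊨_m n} φ_α(h) M_α  (for h ∈ Hₙ)
  ΨFormula : ℕ → H → Qsym m
  ΨFormula n h α = if does (size α ≟ n) then φ_ α h else 0ℚ

{-# OPTIONS --safe #-}
-- Write Ψ(h) = Σ_α c_α(h) M_α.  For any morphism these coefficients are forced: c_() = ε by the
-- counit, c_(ω^j (a+1)) = φ^(j) ∘ π_(a+1) by compatibility with the characters and the grading, and
-- since Δ(M_(p·α)) contains M_(p) ⊗ M_α, comultiplicativity gives c_(p·α) = c_(p) ⊛ c_α for the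
-- convolution (f ⊛ g)(h) = Σ f(h₁) g(h₂).  Unfolding these convolutions along the iterated coproduct
-- is the stated formula.  Conversely, the coefficients defined by this recursion form a morphism:
-- coassociativity makes ⊛ associative, whence c_(β·γ) = c_β ⊛ c_γ; the grading of Δ makes c_α
-- homogeneous of degree |α|; and multiplicativity of Δ carries the product rule
-- φ_n(xy) = Σ_(i+k=n) φ_i(x) φ_k(y) of a character restricted to degrees through the convolutions,
-- its three kinds of terms matching the three ways a quasi-shuffle treats a part: keep it on the
-- left, keep it on the right, or split it.

module Submission where

open import Defs
open import Level using (Level; _⊔_; 0ℓ)
open import Function using (_∘_)
open import Data.Nat as ℕ using (ℕ; zero; suc; _∸_; _≤_; _<_)
import Data.Nat.Properties as ℕ
open import Data.Fin using (Fin; zero; suc)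
open import Data.Product using (Σ; _×_; _,_; proj₁; proj₂)
open import Data.List using (List; []; _∷_; _++_; map; concatMap; upTo; length)
import Data.List.Properties as List
open import Data.List.Membership.Propositional using (_∈_)
open import Data.List.Membership.Propositional.Properties using (∈-upTo⁻)
open import Data.List.Relation.Unary.Any using (here; there)
open import Data.Vec using (Vec; lookup; _∷_; []; _[_]≔_)
open import Data.Vec.Relation.Unary.All using (All; _∷_; [])
open import Data.Rational using (ℚ; 0ℚ; 1ℚ; _+_; _*_)
open import Data.Rational.Properties
  using (+-identityˡ; +-identityʳ; +-assoc; *-assoc; *-identityˡ; *-identityʳ; *-zeroˡ; *-zeroʳ;
         *-distribˡ-+; *-distribʳ-+; +-*-commutativeRing)
open import Data.Maybe using (nothing)
open import Data.Empty using (⊥-elim)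
open import Relation.Nullary using (Dec; does; yes; no)
open import Relation.Nullary.Decidable using (dec-true; dec-false)
open import Data.Bool using (Bool; if_then_else_)
open import Relation.Binary.PropositionalEquality
  using (_≡_; _≢_; refl; sym; trans; cong; cong₂; module ≡-Reasoning)
open import Tactic.RingSolver using (solve-∀)
open import Tactic.RingSolver.Core.AlmostCommutativeRing using (AlmostCommutativeRing; fromCommutativeRing)

open ≡-Reasoning

private
  variable
    a b c d : Level
    A : Set a
    B : Set b
    C : Set c
    D : Set d

  ℚ-ring : AlmostCommutativeRing 0ℓ 0ℓ
  ℚ-ring = fromCommutativeRing +-*-commutativeRing (λ _ → nothing)

  x*[y*z]≡y*[x*z] : ∀ x y z → x * (y * z) ≡ y * (x * z)
  x*[y*z]≡y*[x*z] = solve-∀ ℚ-ring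

  [x*y]*z≡x*[z*y] : ∀ x y z → (x * y) * z ≡ x * (z * y)
  [x*y]*z≡x*[z*y] = solve-∀ ℚ-ring

∑ : List A → (A → ℚ) → ℚ
∑ xs f = sumℚ (map f xs)

∑-syntax : List A → (A → ℚ) → ℚ
∑-syntax = ∑

infix 5 ∑-syntax
syntax ∑-syntax xs (λ x → e) = ∑[ x ∈ xs ] e

∑-cong-∈ : (xs : List A) {f g : A → ℚ} → (∀ {x} → x ∈ xs → f x ≡ g x) → ∑ xs f ≡ ∑ xs g
∑-cong-∈ []       eq = refl
∑-cong-∈ (x ∷ xs) eq = cong₂ _+_ (eq (here refl)) (∑-cong-∈ xs (eq ∘ there))

∑-cong : (xs : List A) {f g : A → ℚ} → (∀ x → f x ≡ g x) → ∑ xs f ≡ ∑ xs g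
∑-cong xs eq = ∑-cong-∈ xs (λ {x} _ → eq x)

∑-zero : (xs : List A) {f : A → ℚ} → (∀ {x} → x ∈ xs → f x ≡ 0ℚ) → ∑ xs f ≡ 0ℚ
∑-zero []       eq = refl
∑-zero (x ∷ xs) eq = cong₂ _+_ (eq (here refl)) (∑-zero xs (eq ∘ there))

∑-++ : (xs ys : List A) (f : A → ℚ) → ∑ (xs ++ ys) f ≡ ∑ xs f + ∑ ys f
∑-++ []       ys f = sym (+-identityˡ _)
∑-++ (x ∷ xs) ys f = trans (cong (f x +_) (∑-++ xs ys f)) (sym (+-assoc (f x) _ _))

∑-map : (xs : List A) (g : A → B) (f : B → ℚ) → ∑ (map g xs) f ≡ ∑[ x ∈ xs ] f (g x)
∑-map xs g f = cong sumℚ (sym (List.map-∘ xs))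

∑-concatMap : (xs : List A) (g : A → List B) (f : B → ℚ) →
  ∑ (concatMap g xs) f ≡ ∑[ x ∈ xs ] ∑ (g x) f
∑-concatMap []       g f = refl
∑-concatMap (x ∷ xs) g f = trans (∑-++ (g x) _ f) (cong (∑ (g x) f +_) (∑-concatMap xs g f))

∑-concatMap-map : (xs : List A) (ys : A → List B) (g : A → B → C) (f : C → ℚ) →
  ∑ (concatMap (λ x → map (g x) (ys x)) xs) f ≡ ∑[ x ∈ xs ] ∑[ y ∈ ys x ] f (g x y)
∑-concatMap-map xs ys g f = trans (∑-concatMap xs _ f) (∑-cong xs (λ x → ∑-map (ys x) (g x) f))

∑-distrib-+ : (xs : List A) (f g : A → ℚ) → ∑[ x ∈ xs ] (f x + g x) ≡ ∑ xs f + ∑ xs g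
∑-distrib-+ []       f g = refl
∑-distrib-+ (x ∷ xs) f g =
  trans (cong (f x + g x +_) (∑-distrib-+ xs f g)) (interchange (f x) (g x) (∑ xs f) (∑ xs g))
  where
  interchange : ∀ p q r s → (p + q) + (r + s) ≡ (p + r) + (q + s)
  interchange = solve-∀ ℚ-ring

*-distribˡ-∑ : (r : ℚ) (xs : List A) (f : A → ℚ) → r * ∑ xs f ≡ ∑[ x ∈ xs ] r * f x
*-distribˡ-∑ r []       f = *-zeroʳ r
*-distribˡ-∑ r (x ∷ xs) f = trans (*-distribˡ-+ r (f x) _) (cong (r * f x +_) (*-distribˡ-∑ r xs f))

*-distribʳ-∑ : (r : ℚ) (xs : List A) (f : A → ℚ) → ∑ xs f * r ≡ ∑[ x ∈ xs ] f x * r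
*-distribʳ-∑ r []       f = *-zeroˡ r
*-distribʳ-∑ r (x ∷ xs) f = trans (*-distribʳ-+ r (f x) _) (cong (f x * r +_) (*-distribʳ-∑ r xs f))

∑-comm : (xs : List A) (ys : List B) (f : A → B → ℚ) →
  ∑[ x ∈ xs ] ∑[ y ∈ ys ] f x y ≡ ∑[ y ∈ ys ] ∑[ x ∈ xs ] f x y
∑-comm []       ys f = sym (∑-zero ys (λ _ → refl))
∑-comm (x ∷ xs) ys f = trans (cong (∑ ys (f x) +_) (∑-comm xs ys f)) (sym (∑-distrib-+ ys (f x) _))

∑-*-∑ : (xs : List A) (ys : List B) (f : A → ℚ) (g : B → ℚ) →
  ∑ xs f * ∑ ys g ≡ ∑[ x ∈ xs ] ∑[ y ∈ ys ] f x * g y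
∑-*-∑ xs ys f g =
  trans (*-distribʳ-∑ (∑ ys g) xs f) (∑-cong xs (λ x → *-distribˡ-∑ (f x) ys g))

∑-comm₂ : (ws : List A) (xs : List B) (ys : List C) (zs : List D) (f : A → B → C → D → ℚ) →
  ∑[ w ∈ ws ] ∑[ x ∈ xs ] ∑[ y ∈ ys ] ∑[ z ∈ zs ] f w x y z
    ≡ ∑[ y ∈ ys ] ∑[ z ∈ zs ] ∑[ w ∈ ws ] ∑[ x ∈ xs ] f w x y z
∑-comm₂ ws xs ys zs f = begin
  ∑[ w ∈ ws ] ∑[ x ∈ xs ] ∑[ y ∈ ys ] ∑[ z ∈ zs ] f w x y z
    ≡⟨ ∑-cong ws (λ w → ∑-comm xs ys _) ⟩
  ∑[ w ∈ ws ] ∑[ y ∈ ys ] ∑[ x ∈ xs ] ∑[ z ∈ zs ] f w x y z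
    ≡⟨ ∑-comm ws ys _ ⟩
  ∑[ y ∈ ys ] ∑[ w ∈ ws ] ∑[ x ∈ xs ] ∑[ z ∈ zs ] f w x y z
    ≡⟨ ∑-cong ys (λ y → ∑-cong ws (λ w → ∑-comm xs zs _)) ⟩
  ∑[ y ∈ ys ] ∑[ w ∈ ws ] ∑[ z ∈ zs ] ∑[ x ∈ xs ] f w x y z
    ≡⟨ ∑-cong ys (λ y → ∑-comm ws zs _) ⟩
  ∑[ y ∈ ys ] ∑[ z ∈ zs ] ∑[ w ∈ ws ] ∑[ x ∈ xs ] f w x y z ∎

∑-upTo-suc : ∀ n (f : ℕ → ℚ) → ∑ (upTo (suc n)) f ≡ ∑ (upTo n) f + f n
∑-upTo-suc n f = begin
  ∑ (upTo (suc n)) f        ≡⟨ cong (λ is → ∑ is f) (sym (List.upTo-∷ʳ n)) ⟩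
  ∑ (upTo n ++ n ∷ []) f    ≡⟨ ∑-++ (upTo n) _ f ⟩
  ∑ (upTo n) f + (f n + 0ℚ) ≡⟨ cong (∑ (upTo n) f +_) (+-identityʳ (f n)) ⟩
  ∑ (upTo n) f + f n        ∎

∑-upTo-shift : ∀ n (f : ℕ → ℚ) → ∑ (upTo (suc n)) f ≡ f 0 + (∑[ i ∈ upTo n ] f (suc i))
∑-upTo-shift n f =
  cong (f 0 +_) (trans (cong (λ is → ∑ is f) (sym (List.map-upTo suc n))) (∑-map (upTo n) suc f))

∑-upTo-delta : ∀ n (f : ℕ → ℚ) {i} → i < n → (∀ {k} → k < n → k ≢ i → f k ≡ 0ℚ) →
  ∑ (upTo n) f ≡ f i
∑-upTo-delta zero    f ()     _
∑-upTo-delta (suc n) f {i} i<1+n off-i with i ℕ.≟ n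
... | yes refl = begin
  ∑ (upTo (suc n)) f ≡⟨ ∑-upTo-suc n f ⟩
  ∑ (upTo n) f + f n ≡⟨ cong (_+ f n) (∑-zero (upTo n) (λ k∈ →
                          off-i (ℕ.m<n⇒m<1+n (∈-upTo⁻ k∈)) (ℕ.<⇒≢ (∈-upTo⁻ k∈)))) ⟩
  0ℚ + f n           ≡⟨ +-identityˡ (f n) ⟩
  f n                ∎
... | no i≢n = begin
  ∑ (upTo (suc n)) f ≡⟨ ∑-upTo-suc n f ⟩
  ∑ (upTo n) f + f n ≡⟨ cong₂ _+_ (∑-upTo-delta n f i<n (off-i ∘ ℕ.m<n⇒m<1+n)) (off-i ℕ.≤-refl (i≢n ∘ sym)) ⟩
  f i + 0ℚ           ≡⟨ +-identityʳ (f i) ⟩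
  f i                ∎
  where
  i<n : i < n
  i<n = ℕ.≤∧≢⇒< (ℕ.≤-pred i<1+n) i≢n

∑-splits : ∀ a (F : ℕ → ℕ → ℚ) →
  ∑[ s ∈ splits a ] F (suc (proj₁ s)) (suc (proj₂ s)) ≡ ∑[ n ∈ upTo a ] F (suc n) (a ∸ n)
∑-splits zero    F = refl
∑-splits (suc a) F =
  trans (∑-map (upTo (suc a)) (λ b → (b , a ∸ b)) (λ s → F (suc (proj₁ s)) (suc (proj₂ s))))
        (∑-cong-∈ (upTo (suc a)) (λ {n} n∈ →
          cong (F (suc n)) (sym (ℕ.+-∸-assoc 1 (ℕ.≤-pred (∈-upTo⁻ n∈))))))

mergedSplits : ∀ {m} → Fin m → ℕ → List (CComp m × CComp m)
mergedSplits j a = map (λ s → ((j , proj₁ s) ∷ [] , (j , proj₂ s) ∷ [])) (splits a)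

unqsh-singleton : ∀ {m} (j : Fin m) a →
  unqsh ((j , a) ∷ []) ≡ ((j , a) ∷ [] , []) ∷ ([] , (j , a) ∷ []) ∷ mergedSplits j a
unqsh-singleton j a = List.++-identityʳ _

-- Every quasi-shuffle producing p ∷ γ comes from one producing γ, with p placed on one side or
-- split over both.
∑-unqsh-∷ : ∀ {m} p (γ : CComp m) (F : CComp m × CComp m → ℚ) →
  ∑ (unqsh (p ∷ γ)) F ≡ ∑[ t ∈ unqsh γ ] ∑[ s ∈ unqsh (p ∷ []) ] F (proj₁ s ++ proj₁ t , proj₂ s ++ proj₂ t)
∑-unqsh-∷ {m} (j , a) γ F = begin
  ∑ (unqsh ((j , a) ∷ γ)) F
    ≡⟨ ∑-concatMap (unqsh γ) _ F ⟩
  ∑[ t ∈ unqsh γ ] (F ((j , a) ∷ proj₁ t , proj₂ t) + (F (proj₁ t , (j , a) ∷ proj₂ t)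
                     + ∑ (map (λ s → ((j , proj₁ s) ∷ proj₁ t , (j , proj₂ s) ∷ proj₂ t)) (splits a)) F))
    ≡⟨ ∑-cong (unqsh γ) (λ t →
         cong (λ z → F ((j , a) ∷ proj₁ t , proj₂ t) + (F (proj₁ t , (j , a) ∷ proj₂ t) + z))
              (trans (∑-map (splits a) _ F) (sym (∑-map (splits a) _ (G t))))) ⟩
  ∑[ t ∈ unqsh γ ] ∑ (((j , a) ∷ [] , []) ∷ ([] , (j , a) ∷ []) ∷ mergedSplits j a) (G t)
    ≡⟨ cong (λ ps → ∑[ t ∈ unqsh γ ] ∑ ps (G t)) (sym (unqsh-singleton j a)) ⟩
  ∑[ t ∈ unqsh γ ] ∑ (unqsh ((j , a) ∷ [])) (G t) ∎
  where
  G : CComp m × CComp m → CComp m × CComp m → ℚ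
  G t s = F (proj₁ s ++ proj₁ t , proj₂ s ++ proj₂ t)

-- Linear functionals and their convolution

module _ {c ℓ} (𝓗 : GCHopf c ℓ) where
  open GCHopf 𝓗

  record IsLinear (f : H → ℚ) : Set (c ⊔ ℓ) where
    field
      resp-≈  : ∀ {x y} → x ≈ᴹ y → f x ≡ f y
      +ᴹ-homo : ∀ x y → f (x +ᴹ y) ≡ f x + f y
      *ₗ-homo : ∀ r x → f (r *ₗ x) ≡ r * f x

  open IsLinear

  module _ {f : H → ℚ} (lin : IsLinear f) where

    linear-0ᴹ : f 0ᴹ ≡ 0ℚ
    linear-0ᴹ = begin
      f 0ᴹ          ≡⟨ resp-≈ lin (≈ᴹ-sym (*ₗ-zeroˡ 0ᴹ)) ⟩
      f (0ℚ *ₗ 0ᴹ)  ≡⟨ *ₗ-homo lin 0ℚ 0ᴹ ⟩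
      0ℚ * f 0ᴹ     ≡⟨ *-zeroˡ (f 0ᴹ) ⟩
      0ℚ            ∎

    linear-sumH : (g : A → H) (xs : List A) → f (sumH V (map g xs)) ≡ ∑[ x ∈ xs ] f (g x)
    linear-sumH g []       = linear-0ᴹ
    linear-sumH g (x ∷ xs) = trans (+ᴹ-homo lin _ _) (cong (f (g x) +_) (linear-sumH g xs))

    linear-sumᴹ : (g : A → ℚ × H) (xs : List A) →
      f (sumᴹ V (map g xs)) ≡ ∑[ x ∈ xs ] proj₁ (g x) * f (proj₂ (g x))
    linear-sumᴹ g []       = linear-0ᴹ
    linear-sumᴹ g (x ∷ xs) = trans (+ᴹ-homo lin _ _) (cong₂ _+_ (*ₗ-homo lin _ _) (linear-sumᴹ g xs))

  linear-ext : ∀ {f g} → IsLinear f → IsLinear g →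
    (∀ n x → f (π n x) ≡ g (π n x)) → ∀ x → f x ≡ g x
  linear-ext {f} {g} lin-f lin-g homogeneous-eq x = begin
    f x                      ≡⟨ resp-≈ lin-f x≈∑πx ⟩
    f (sumH V (map πx upToN)) ≡⟨ linear-sumH lin-f πx upToN ⟩
    ∑[ n ∈ upToN ] f (πx n)  ≡⟨ ∑-cong upToN (λ n → homogeneous-eq n x) ⟩
    ∑[ n ∈ upToN ] g (πx n)  ≡⟨ sym (linear-sumH lin-g πx upToN) ⟩
    g (sumH V (map πx upToN)) ≡⟨ sym (resp-≈ lin-g x≈∑πx) ⟩
    g x                      ∎
    where
    πx : ℕ → H
    πx n = π n x
    upToN : List ℕ
    upToN = upTo (proj₁ (π-decomp x))
    x≈∑πx : x ≈ᴹ sumH V (map πx upToN)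
    x≈∑πx = proj₂ (π-decomp x)

  bilinear-ext : {F G : H → H → ℚ} →
    (∀ y → IsLinear (λ x → F x y)) → (∀ x → IsLinear (F x)) →
    (∀ y → IsLinear (λ x → G x y)) → (∀ x → IsLinear (G x)) →
    (∀ i k x y → F (π i x) (π k y) ≡ G (π i x) (π k y)) → ∀ x y → F x y ≡ G x y
  bilinear-ext lin-F₁ lin-F₂ lin-G₁ lin-G₂ homogeneous-eq x y =
    linear-ext (lin-F₁ y) (lin-G₁ y)
      (λ i x′ → linear-ext (lin-F₂ (π i x′)) (lin-G₂ (π i x′)) (λ k y′ → homogeneous-eq i k x′ y′) y) x

  ε-linear : IsLinear ε
  ε-linear = record { resp-≈ = ε-cong ; +ᴹ-homo = ε-add ; *ₗ-homo = ε-scale }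

  *ʳ-linear : ∀ {f} → IsLinear f → ∀ r → IsLinear (λ x → f x * r)
  *ʳ-linear {f} lin r = record
    { resp-≈  = λ e → cong (_* r) (resp-≈ lin e)
    ; +ᴹ-homo = λ x y → trans (cong (_* r) (+ᴹ-homo lin x y)) (*-distribʳ-+ r (f x) (f y))
    ; *ₗ-homo = λ s x → trans (cong (_* r) (*ₗ-homo lin s x)) (*-assoc s (f x) r)
    }

  *ˡ-linear : ∀ {f} → IsLinear f → ∀ r → IsLinear (λ x → r * f x)
  *ˡ-linear {f} lin r = record
    { resp-≈  = λ e → cong (r *_) (resp-≈ lin e)
    ; +ᴹ-homo = λ x y → trans (cong (r *_) (+ᴹ-homo lin x y)) (*-distribˡ-+ r (f x) (f y))
    ; *ₗ-homo = λ s x → trans (cong (r *_) (*ₗ-homo lin s x)) (x*[y*z]≡y*[x*z] r s (f x))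
    }

  ∑-linear : (xs : List A) {F : A → H → ℚ} → (∀ i → IsLinear (F i)) → IsLinear (λ x → ∑[ i ∈ xs ] F i x)
  ∑-linear xs {F} lin = record
    { resp-≈  = λ e → ∑-cong xs (λ i → resp-≈ (lin i) e)
    ; +ᴹ-homo = λ x y → trans (∑-cong xs (λ i → +ᴹ-homo (lin i) x y)) (∑-distrib-+ xs (λ i → F i x) _)
    ; *ₗ-homo = λ r x → trans (∑-cong xs (λ i → *ₗ-homo (lin i) r x)) (sym (*-distribˡ-∑ r xs _))
    }

  ·ʳ-linear : ∀ {f} → IsLinear f → ∀ y → IsLinear (λ x → f (x · y))
  ·ʳ-linear lin y = record
    { resp-≈  = λ e → resp-≈ lin (·-cong e ≈ᴹ-refl)
    ; +ᴹ-homo = λ x x′ → trans (resp-≈ lin (·-distribʳ x x′ y)) (+ᴹ-homo lin _ _)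
    ; *ₗ-homo = λ r x → trans (resp-≈ lin (·-scaleˡ r x y)) (*ₗ-homo lin _ _)
    }

  ·ˡ-linear : ∀ {f} → IsLinear f → ∀ x → IsLinear (λ y → f (x · y))
  ·ˡ-linear lin x = record
    { resp-≈  = λ e → resp-≈ lin (·-cong ≈ᴹ-refl e)
    ; +ᴹ-homo = λ y y′ → trans (resp-≈ lin (·-distribˡ x y y′)) (+ᴹ-homo lin _ _)
    ; *ₗ-homo = λ r y → trans (resp-≈ lin (·-scaleʳ r x y)) (*ₗ-homo lin _ _)
    }

  ⨂ : ∀ {k} → Vec (H → ℚ) k → Vec H k → ℚ
  ⨂ []       []       = 1ℚ
  ⨂ (f ∷ fs) (x ∷ xs) = f x * ⨂ fs xs

  ⨂-multilinear : ∀ {k} {fs : Vec (H → ℚ) k} → All IsLinear fs → MultiLinear V k (⨂ fs)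
  ⨂-multilinear [] = record { cong = λ { [] [] _ → refl } ; addᵢ = λ () ; homᵢ = λ () }
  ⨂-multilinear {fs = f ∷ fs} (lin ∷ lins) = record { cong = resp ; addᵢ = add ; homᵢ = hom }
    where
    open MultiLinear (⨂-multilinear lins) renaming (cong to resp′; addᵢ to add′; homᵢ to hom′)

    resp : ∀ v w → (∀ i → lookup v i ≈ᴹ lookup w i) → ⨂ (f ∷ fs) v ≡ ⨂ (f ∷ fs) w
    resp (x ∷ xs) (y ∷ ys) eq = cong₂ _*_ (resp-≈ lin (eq zero)) (resp′ xs ys (eq ∘ suc))

    add : ∀ i v x y → ⨂ (f ∷ fs) (v [ i ]≔ (x +ᴹ y))
                    ≡ ⨂ (f ∷ fs) (v [ i ]≔ x) + ⨂ (f ∷ fs) (v [ i ]≔ y)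
    add zero    (_ ∷ xs) x y = trans (cong (_* ⨂ fs xs) (+ᴹ-homo lin x y)) (*-distribʳ-+ _ (f x) (f y))
    add (suc i) (z ∷ xs) x y = trans (cong (f z *_) (add′ i xs x y)) (*-distribˡ-+ (f z) _ _)

    hom : ∀ i v r x → ⨂ (f ∷ fs) (v [ i ]≔ (r *ₗ x)) ≡ r * ⨂ (f ∷ fs) (v [ i ]≔ x)
    hom zero    (_ ∷ xs) r x = trans (cong (_* ⨂ fs xs) (*ₗ-homo lin r x)) (*-assoc r (f x) _)
    hom (suc i) (z ∷ xs) r x = trans (cong (f z *_) (hom′ i xs r x)) (x*[y*z]≡y*[x*z] (f z) r _)

  multilinear-resp : ∀ {k} {B B′ : Vec H k → ℚ} → (∀ v → B v ≡ B′ v) → MultiLinear V k B → MultiLinear V k B′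
  multilinear-resp {B = B} {B′} B≗B′ ml = record
    { cong = λ v w eq → trans (sym (B≗B′ v)) (trans (resp v w eq) (B≗B′ w))
    ; addᵢ = λ i v x y → trans (sym (B≗B′ _)) (trans (addᵢ i v x y) (cong₂ _+_ (B≗B′ _) (B≗B′ _)))
    ; homᵢ = λ i v r x → trans (sym (B≗B′ _)) (trans (homᵢ i v r x) (cong (r *_) (B≗B′ _)))
    }
    where open MultiLinear ml renaming (cong to resp)

  left right : ℚ × Vec H 2 → H
  left  t = lookup (proj₂ t) zero
  right t = lookup (proj₂ t) (suc zero)

  -- _⊗_ reads its arguments by lookup so that it unfolds on the vectors in the axioms of GCHopf,
  -- while ⨂ matches on the vector so that multilinearity goes by induction.
  _⊗_ : (H → ℚ) → (H → ℚ) → Vec H 2 → ℚ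
  (f ⊗ g) v = f (lookup v zero) * g (lookup v (suc zero))

  ⊗-multilinear : ∀ {f g} → IsLinear f → IsLinear g → MultiLinear V 2 (f ⊗ g)
  ⊗-multilinear {f} {g} lin-f lin-g =
    multilinear-resp (λ { (x ∷ y ∷ []) → cong (f x *_) (*-identityʳ (g y)) })
                     (⨂-multilinear (lin-f ∷ lin-g ∷ []))

  Δ-linear : ∀ {B} → MultiLinear V 2 B → IsLinear (λ x → evalT V B (Δ x))
  Δ-linear {B} ml = record
    { resp-≈  = λ e → Δ-cong e B ml
    ; +ᴹ-homo = λ x y → trans (Δ-add x y B ml) (∑-++ (Δ x) (Δ y) _)
    ; *ₗ-homo = λ r x → begin
        evalT V B (Δ (r *ₗ x))                     ≡⟨ Δ-scale r x B ml ⟩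
        evalT V B (scaleT V r (Δ x))               ≡⟨ ∑-map (Δ x) _ _ ⟩
        ∑[ t ∈ Δ x ] (r * proj₁ t) * B (proj₂ t)   ≡⟨ ∑-cong (Δ x) (λ t → *-assoc r (proj₁ t) _) ⟩
        ∑[ t ∈ Δ x ] r * (proj₁ t * B (proj₂ t))   ≡⟨ sym (*-distribˡ-∑ r (Δ x) _) ⟩
        r * evalT V B (Δ x)                        ∎
    }

  _⊛_ : (H → ℚ) → (H → ℚ) → H → ℚ
  (f ⊛ g) x = evalT V (f ⊗ g) (Δ x)

  ⊛-linear : ∀ {f g} → IsLinear f → IsLinear g → IsLinear (f ⊛ g)
  ⊛-linear lin-f lin-g = Δ-linear (⊗-multilinear lin-f lin-g)

  ⊛-congʳ : ∀ f {g g′} → (∀ x → g x ≡ g′ x) → ∀ x → (f ⊛ g) x ≡ (f ⊛ g′) x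
  ⊛-congʳ f g≗g′ x = ∑-cong (Δ x) (λ t → cong (λ z → proj₁ t * (f (left t) * z)) (g≗g′ (right t)))

  ⊛-identityˡ : ∀ {f} → IsLinear f → ∀ x → (ε ⊛ f) x ≡ f x
  ⊛-identityˡ {f} lin x = sym (begin
    f x
      ≡⟨ resp-≈ lin (≈ᴹ-sym (ε-counitˡ x)) ⟩
    f (sumᴹ V (map (λ t → (proj₁ t * ε (left t) , right t)) (Δ x)))
      ≡⟨ linear-sumᴹ lin _ (Δ x) ⟩
    ∑[ t ∈ Δ x ] (proj₁ t * ε (left t)) * f (right t)
      ≡⟨ ∑-cong (Δ x) (λ t → *-assoc (proj₁ t) _ _) ⟩
    (ε ⊛ f) x ∎)

  ⊛-identityʳ : ∀ {f} → IsLinear f → ∀ x → (f ⊛ ε) x ≡ f x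
  ⊛-identityʳ {f} lin x = sym (begin
    f x
      ≡⟨ resp-≈ lin (≈ᴹ-sym (ε-counitʳ x)) ⟩
    f (sumᴹ V (map (λ t → (proj₁ t * ε (right t) , left t)) (Δ x)))
      ≡⟨ linear-sumᴹ lin _ (Δ x) ⟩
    ∑[ t ∈ Δ x ] (proj₁ t * ε (right t)) * f (left t)
      ≡⟨ ∑-cong (Δ x) (λ t → [x*y]*z≡x*[z*y] (proj₁ t) _ _) ⟩
    (f ⊛ ε) x ∎)

  ⊛-assoc : ∀ {f g k} → IsLinear f → IsLinear g → IsLinear k → ∀ x → ((f ⊛ g) ⊛ k) x ≡ (f ⊛ (g ⊛ k)) x
  ⊛-assoc {f} {g} {k} lin-f lin-g lin-k x = begin
    ((f ⊛ g) ⊛ k) x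
      ≡⟨ ∑-cong (Δ x) (λ t → expandˡ (proj₁ t) (left t) (k (right t))) ⟩
    ∑[ t ∈ Δ x ] ∑[ t′ ∈ Δ (left t) ] (proj₁ t * proj₁ t′) * B₃ (v3 (left t′) (right t′) (right t))
      ≡⟨ sym (∑-concatMap-map (Δ x) (λ t → Δ (left t)) _ _) ⟩
    evalT V B₃ (concatMap (λ t → map (λ t′ → (proj₁ t * proj₁ t′ , v3 (left t′) (right t′) (right t)))
                                     (Δ (left t))) (Δ x))
      ≡⟨ Δ-coassoc x B₃ B₃-multilinear ⟩
    evalT V B₃ (concatMap (λ t → map (λ t′ → (proj₁ t * proj₁ t′ , v3 (left t) (left t′) (right t′)))
                                     (Δ (right t))) (Δ x))
      ≡⟨ ∑-concatMap-map (Δ x) (λ t → Δ (right t)) _ _ ⟩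
    ∑[ t ∈ Δ x ] ∑[ t′ ∈ Δ (right t) ] (proj₁ t * proj₁ t′) * B₃ (v3 (left t) (left t′) (right t′))
      ≡⟨ ∑-cong (Δ x) (λ t → sym (expandʳ (proj₁ t) (f (left t)) (right t))) ⟩
    (f ⊛ (g ⊛ k)) x ∎
    where
    B₃ : Vec H 3 → ℚ
    B₃ v = f (lookup v zero) * (g (lookup v (suc zero)) * k (lookup v (suc (suc zero))))

    B₃-multilinear : MultiLinear V 3 B₃
    B₃-multilinear = multilinear-resp (λ { (x ∷ y ∷ z ∷ []) → cong (λ w → f x * (g y * w)) (*-identityʳ (k z)) })
                                      (⨂-multilinear (lin-f ∷ lin-g ∷ lin-k ∷ []))

    expandˡ : ∀ q y r → q * ((f ⊛ g) y * r) ≡ ∑[ t ∈ Δ y ] (q * proj₁ t) * (f (left t) * (g (right t) * r))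
    expandˡ q y r = begin
      q * ((f ⊛ g) y * r)  ≡⟨ cong (q *_) (*-distribʳ-∑ r (Δ y) _) ⟩
      q * (∑[ t ∈ Δ y ] (proj₁ t * (f (left t) * g (right t))) * r)
        ≡⟨ *-distribˡ-∑ q (Δ y) _ ⟩
      ∑[ t ∈ Δ y ] q * ((proj₁ t * (f (left t) * g (right t))) * r)
        ≡⟨ ∑-cong (Δ y) (λ t → regroup q (proj₁ t) (f (left t)) (g (right t)) r) ⟩
      ∑[ t ∈ Δ y ] (q * proj₁ t) * (f (left t) * (g (right t) * r)) ∎
      where
      regroup : ∀ q p a b c → q * ((p * (a * b)) * c) ≡ (q * p) * (a * (b * c))
      regroup = solve-∀ ℚ-ring

    expandʳ : ∀ q a y → q * (a * (g ⊛ k) y) ≡ ∑[ t ∈ Δ y ] (q * proj₁ t) * (a * (g (left t) * k (right t)))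
    expandʳ q a y = begin
      q * (a * (g ⊛ k) y)  ≡⟨ cong (q *_) (*-distribˡ-∑ a (Δ y) _) ⟩
      q * (∑[ t ∈ Δ y ] a * (proj₁ t * (g (left t) * k (right t))))
        ≡⟨ *-distribˡ-∑ q (Δ y) _ ⟩
      ∑[ t ∈ Δ y ] q * (a * (proj₁ t * (g (left t) * k (right t))))
        ≡⟨ ∑-cong (Δ y) (λ t → regroup q a (proj₁ t) (g (left t) * k (right t))) ⟩
      ∑[ t ∈ Δ y ] (q * proj₁ t) * (a * (g (left t) * k (right t))) ∎
      where
      regroup : ∀ q a p b → q * (a * (p * b)) ≡ (q * p) * (a * b)
      regroup = solve-∀ ℚ-ring

  ⊛-𝟙 : ∀ {f g} → IsLinear f → IsLinear g → (f ⊛ g) 𝟙 ≡ f 𝟙 * g 𝟙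
  ⊛-𝟙 {f} {g} lin-f lin-g = begin
    (f ⊛ g) 𝟙                   ≡⟨ Δ-unit (f ⊗ g) (⊗-multilinear lin-f lin-g) ⟩
    1ℚ * (f 𝟙 * g 𝟙) + 0ℚ       ≡⟨ +-identityʳ _ ⟩
    1ℚ * (f 𝟙 * g 𝟙)            ≡⟨ *-identityˡ _ ⟩
    f 𝟙 * g 𝟙                   ∎

  Homogeneous : ℕ → (H → ℚ) → Set c
  Homogeneous d f = ∀ n x → d ≢ n → f (π n x) ≡ 0ℚ

  ε-homogeneous : Homogeneous 0 ε
  ε-homogeneous zero    x 0≢0 = ⊥-elim (0≢0 refl)
  ε-homogeneous (suc n) x _   = ε-graded n x

  ⊛-homogeneous : ∀ {f g d e} → IsLinear f → IsLinear g → Homogeneous d f → Homogeneous e g →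
    Homogeneous (d ℕ.+ e) (f ⊛ g)
  ⊛-homogeneous {f} {g} {d} {e} lin-f lin-g hom-f hom-g n x d+e≢n = begin
    (f ⊛ g) (π n x)
      ≡⟨ Δ-graded n x (f ⊗ g) (⊗-multilinear lin-f lin-g) ⟩
    evalT V (f ⊗ g) (concatMap (λ i → map (λ t → (proj₁ t , v2 (π i (left t)) (π (n ∸ i) (right t))))
                                          (Δ (π n x))) (upTo (suc n)))
      ≡⟨ ∑-concatMap-map (upTo (suc n)) (λ _ → Δ (π n x)) _ _ ⟩
    ∑[ i ∈ upTo (suc n) ] ∑[ t ∈ Δ (π n x) ] proj₁ t * (f (π i (left t)) * g (π (n ∸ i) (right t)))
      ≡⟨ ∑-zero (upTo (suc n)) (λ i∈ → ∑-zero (Δ (π n x)) (λ {t} _ →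
           trans (cong (proj₁ t *_) (vanish (∈-upTo⁻ i∈) (left t) (right t))) (*-zeroʳ (proj₁ t)))) ⟩
    0ℚ ∎
    where
    vanish : ∀ {i} → i < suc n → ∀ y z → f (π i y) * g (π (n ∸ i) z) ≡ 0ℚ
    vanish {i} i≤n y z with d ℕ.≟ i
    ... | yes refl = trans (cong (f (π d y) *_) (hom-g (n ∸ d) z e≢n∸d)) (*-zeroʳ (f (π d y)))
      where
      e≢n∸d : e ≢ n ∸ d
      e≢n∸d e≡n∸d = d+e≢n (trans (cong (d ℕ.+_) e≡n∸d) (ℕ.m+[n∸m]≡n (ℕ.≤-pred i≤n)))
    ... | no d≢i   = trans (cong (_* g (π (n ∸ i) z)) (hom-f i y d≢i)) (*-zeroˡ (g (π (n ∸ i) z)))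

  ProductFormula : (H → ℚ) → List A → (A → H → ℚ) → (A → H → ℚ) → Set c
  ProductFormula f is l r = ∀ x y → f (x · y) ≡ ∑[ i ∈ is ] l i x * r i y

  ⊛-productFormula : ∀ {f g} {is : List A} {ks : List B} {fl fr gl gr} →
    IsLinear f → IsLinear g → ProductFormula f is fl fr → ProductFormula g ks gl gr →
    ∀ x y → (f ⊛ g) (x · y) ≡ ∑[ i ∈ is ] ∑[ k ∈ ks ] (fl i ⊛ gl k) x * (fr i ⊛ gr k) y
  ⊛-productFormula {A = I} {B = K} {f = f} {g} {is} {ks} {fl} {fr} {gl} {gr} lin-f lin-g f-· g-· x y = begin
    (f ⊛ g) (x · y)
      ≡⟨ Δ-mult x y (f ⊗ g) (⊗-multilinear lin-f lin-g) ⟩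
    evalT V (f ⊗ g) (concatMap (λ t → map (λ t′ → (proj₁ t * proj₁ t′ ,
                                                  v2 (left t · left t′) (right t · right t′))) (Δ y)) (Δ x))
      ≡⟨ ∑-concatMap-map (Δ x) (λ _ → Δ y) _ _ ⟩
    ∑[ t ∈ Δ x ] ∑[ t′ ∈ Δ y ] (proj₁ t * proj₁ t′) * (f (left t · left t′) * g (right t · right t′))
      ≡⟨ ∑-cong (Δ x) (λ t → ∑-cong (Δ y) (λ t′ → expand t t′)) ⟩
    ∑[ t ∈ Δ x ] ∑[ t′ ∈ Δ y ] ∑[ i ∈ is ] ∑[ k ∈ ks ] term i k t t′
      ≡⟨ ∑-comm₂ (Δ x) (Δ y) is ks _ ⟩
    ∑[ i ∈ is ] ∑[ k ∈ ks ] ∑[ t ∈ Δ x ] ∑[ t′ ∈ Δ y ] term i k t t′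
      ≡⟨ ∑-cong is (λ i → ∑-cong ks (λ k → sym (∑-*-∑ (Δ x) (Δ y) _ _))) ⟩
    ∑[ i ∈ is ] ∑[ k ∈ ks ] (fl i ⊛ gl k) x * (fr i ⊛ gr k) y ∎
    where
    term : I → K → ℚ × Vec H 2 → ℚ × Vec H 2 → ℚ
    term i k t t′ = (proj₁ t * (fl i (left t) * gl k (right t)))
                  * (proj₁ t′ * (fr i (left t′) * gr k (right t′)))

    expand : ∀ t t′ → (proj₁ t * proj₁ t′) * (f (left t · left t′) * g (right t · right t′))
                    ≡ ∑[ i ∈ is ] ∑[ k ∈ ks ] term i k t t′
    expand t t′ = begin
      q * (f (left t · left t′) * g (right t · right t′))
        ≡⟨ cong (q *_) (cong₂ _*_ (f-· (left t) (left t′)) (g-· (right t) (right t′))) ⟩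
      q * ((∑[ i ∈ is ] fl i (left t) * fr i (left t′)) * (∑[ k ∈ ks ] gl k (right t) * gr k (right t′)))
        ≡⟨ cong (q *_) (∑-*-∑ is ks _ _) ⟩
      q * (∑[ i ∈ is ] ∑[ k ∈ ks ] (fl i (left t) * fr i (left t′)) * (gl k (right t) * gr k (right t′)))
        ≡⟨ trans (*-distribˡ-∑ q is _) (∑-cong is (λ i → *-distribˡ-∑ q ks _)) ⟩
      ∑[ i ∈ is ] ∑[ k ∈ ks ] q * ((fl i (left t) * fr i (left t′)) * (gl k (right t) * gr k (right t′)))
        ≡⟨ ∑-cong is (λ i → ∑-cong ks (λ k → regroup (proj₁ t) (proj₁ t′)
             (fl i (left t)) (fr i (left t′)) (gl k (right t)) (gr k (right t′)))) ⟩
      ∑[ i ∈ is ] ∑[ k ∈ ks ] term i k t t′ ∎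
      where
      q : ℚ
      q = proj₁ t * proj₁ t′

      regroup : ∀ q q′ a b c d → (q * q′) * ((a * b) * (c * d)) ≡ (q * (a * c)) * (q′ * (b * d))
      regroup = solve-∀ ℚ-ring

  -- Homogeneous components of a character

  module _ (ψ : Character 𝓗) where
    open Character ψ

    component : ℕ → H → ℚ
    component n x = ch (π n x)

    component-linear : ∀ n → IsLinear (component n)
    component-linear n = record
      { resp-≈  = λ e → ch-cong (π-cong n e)
      ; +ᴹ-homo = λ x y → trans (ch-cong (π-add n x y)) (ch-add _ _)
      ; *ₗ-homo = λ r x → trans (ch-cong (π-scale n r x)) (ch-scale _ _)
      }

    component-idem : ∀ n x → component n (π n x) ≡ component n x
    component-idem n x = ch-cong (π-idem n x)

    component-homogeneous : ∀ n → Homogeneous n (component n)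
    component-homogeneous n m x n≢m = begin
      ch (π n (π m x))  ≡⟨ ch-cong (π-orth n m x n≢m) ⟩
      ch 0ᴹ             ≡⟨ linear-0ᴹ ch-linear ⟩
      0ℚ                ∎
      where
      ch-linear : IsLinear ch
      ch-linear = record { resp-≈ = ch-cong ; +ᴹ-homo = ch-add ; *ₗ-homo = ch-scale }

    ch-π₀ : ∀ x → ch (π 0 x) ≡ ε (π 0 x)
    ch-π₀ x = begin
      ch (π 0 x)              ≡⟨ ch-cong (connected x) ⟩
      ch (ε (π 0 x) *ₗ 𝟙)     ≡⟨ ch-scale _ _ ⟩
      ε (π 0 x) * ch 𝟙        ≡⟨ cong (ε (π 0 x) *_) ch-unit ⟩
      ε (π 0 x) * 1ℚ          ≡⟨ *-identityʳ _ ⟩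
      ε (π 0 x)               ∎

    component-zero : ∀ x → component 0 x ≡ ε x
    component-zero = linear-ext (component-linear 0) ε-linear on-π
      where
      on-π : ∀ n x → component 0 (π n x) ≡ ε (π n x)
      on-π zero    x = trans (component-idem 0 x) (ch-π₀ x)
      on-π (suc n) x = trans (component-homogeneous 0 (suc n) x (λ ())) (sym (ε-graded n x))

    component-𝟙 : ∀ n → component (suc n) 𝟙 ≡ 0ℚ
    component-𝟙 n = trans (resp-≈ (component-linear (suc n)) (≈ᴹ-sym 𝟙-graded))
                          (component-homogeneous (suc n) 0 𝟙 (λ ()))

    component-·-homogeneous : ∀ N i k x y → component N (π i x · π k y)
      ≡ ∑[ n ∈ upTo (suc N) ] component n (π i x) * component (N ∸ n) (π k y)
    component-·-homogeneous N i k x y with i ℕ.+ k ℕ.≟ N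
    ... | yes refl = begin
      ch (π (i ℕ.+ k) (π i x · π k y))  ≡⟨ ch-cong (·-graded i k x y) ⟩
      ch (π i x · π k y)                ≡⟨ ch-mult _ _ ⟩
      ch (π i x) * ch (π k y)           ≡⟨ sym (cong₂ _*_ (component-idem i x) (component-idem k y)) ⟩
      component i (π i x) * component k (π k y)
        ≡⟨ cong (λ n → component i (π i x) * component n (π k y)) (sym (ℕ.m+n∸m≡n i k)) ⟩
      component i (π i x) * component (i ℕ.+ k ∸ i) (π k y)
        ≡⟨ sym (∑-upTo-delta (suc (i ℕ.+ k)) term (ℕ.s≤s (ℕ.m≤m+n i k)) (λ {n} _ n≢i →
             trans (cong (_* component (i ℕ.+ k ∸ n) (π k y)) (component-homogeneous n i x n≢i))
                   (*-zeroˡ (component (i ℕ.+ k ∸ n) (π k y))))) ⟩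
      ∑[ n ∈ upTo (suc (i ℕ.+ k)) ] term n ∎
      where
      term : ℕ → ℚ
      term n = component n (π i x) * component (i ℕ.+ k ∸ n) (π k y)
    ... | no i+k≢N = begin
      component N (π i x · π k y)               ≡⟨ resp-≈ (component-linear N) (≈ᴹ-sym (·-graded i k x y)) ⟩
      component N (π (i ℕ.+ k) (π i x · π k y)) ≡⟨ component-homogeneous N (i ℕ.+ k) _ (i+k≢N ∘ sym) ⟩
      0ℚ                                        ≡⟨ sym (∑-zero (upTo (suc N)) (vanish ∘ ∈-upTo⁻)) ⟩
      ∑[ n ∈ upTo (suc N) ] component n (π i x) * component (N ∸ n) (π k y) ∎
      where
      vanish : ∀ {n} → n < suc N → component n (π i x) * component (N ∸ n) (π k y) ≡ 0ℚ
      vanish {n} n≤N with n ℕ.≟ i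
      ... | yes refl = trans (cong (component n (π n x) *_) (component-homogeneous (N ∸ n) k y N∸n≢k))
                             (*-zeroʳ (component n (π n x)))
        where
        N∸n≢k : N ∸ n ≢ k
        N∸n≢k N∸n≡k = i+k≢N (trans (cong (n ℕ.+_) (sym N∸n≡k)) (ℕ.m+[n∸m]≡n (ℕ.≤-pred n≤N)))
      ... | no n≢i = trans (cong (_* component (N ∸ n) (π k y)) (component-homogeneous n i x n≢i))
                           (*-zeroˡ (component (N ∸ n) (π k y)))

    component-· : ∀ N x y → component N (x · y) ≡ ∑[ n ∈ upTo (suc N) ] component n x * component (N ∸ n) y
    component-· N = bilinear-ext
      (·ʳ-linear (component-linear N)) (·ˡ-linear (component-linear N))
      (λ y → ∑-linear (upTo (suc N)) (λ n → *ʳ-linear (component-linear n) (component (N ∸ n) y)))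
      (λ x → ∑-linear (upTo (suc N)) (λ n → *ˡ-linear (component-linear (N ∸ n)) (component n x)))
      (component-·-homogeneous N)

    component-suc-· : ∀ a x y → component (suc a) (x · y)
      ≡ component (suc a) x * ε y + (ε x * component (suc a) y
          + (∑[ s ∈ splits a ] component (suc (proj₁ s)) x * component (suc (proj₂ s)) y))
    component-suc-· a x y = begin
      component (suc a) (x · y)
        ≡⟨ component-· (suc a) x y ⟩
      ∑[ n ∈ upTo (suc (suc a)) ] g n * h (suc a ∸ n)
        ≡⟨ ∑-upTo-shift (suc a) (λ n → g n * h (suc a ∸ n)) ⟩
      g 0 * h (suc a) + (∑[ n ∈ upTo (suc a) ] g (suc n) * h (a ∸ n))
        ≡⟨ cong (g 0 * h (suc a) +_) (∑-upTo-suc a (λ n → g (suc n) * h (a ∸ n))) ⟩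
      g 0 * h (suc a) + (middle + g (suc a) * h (a ∸ a))
        ≡⟨ cong (λ n → g 0 * h (suc a) + (middle + g (suc a) * h n)) (ℕ.n∸n≡0 a) ⟩
      g 0 * h (suc a) + (middle + g (suc a) * h 0)
        ≡⟨ rotate (g 0 * h (suc a)) middle (g (suc a) * h 0) ⟩
      g (suc a) * h 0 + (g 0 * h (suc a) + middle)
        ≡⟨ cong₂ (λ u v → g (suc a) * v + (u * h (suc a) + middle)) (component-zero x) (component-zero y) ⟩
      g (suc a) * ε y + (ε x * h (suc a) + middle)
        ≡⟨ cong (λ z → g (suc a) * ε y + (ε x * h (suc a) + z)) (sym (∑-splits a (λ u v → g u * h v))) ⟩
      g (suc a) * ε y + (ε x * h (suc a) + (∑[ s ∈ splits a ] g (suc (proj₁ s)) * h (suc (proj₂ s)))) ∎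
      where
      g h : ℕ → ℚ
      g n = component n x
      h n = component n y

      middle : ℚ
      middle = ∑[ n ∈ upTo a ] g (suc n) * h (a ∸ n)

      rotate : ∀ p q r → p + (q + r) ≡ r + (p + q)
      rotate = solve-∀ ℚ-ring

  -- The universal morphism

  module _ {m} (φs : Fin m → Character 𝓗) where

    coefficient : CComp m → H → ℚ
    coefficient []            = ε
    coefficient ((j , a) ∷ α) = component (φs j) (suc a) ⊛ coefficient α

    coefficient-linear : ∀ α → IsLinear (coefficient α)
    coefficient-linear []            = ε-linear
    coefficient-linear ((j , a) ∷ α) = ⊛-linear (component-linear (φs j) (suc a)) (coefficient-linear α)

    coefficient-homogeneous : ∀ α → Homogeneous (size α) (coefficient α)
    coefficient-homogeneous []            = ε-homogeneous
    coefficient-homogeneous ((j , a) ∷ α) =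
      ⊛-homogeneous (component-linear (φs j) (suc a)) (coefficient-linear α)
                    (component-homogeneous (φs j) (suc a)) (coefficient-homogeneous α)

    coefficient-singleton : ∀ j a x → coefficient ((j , a) ∷ []) x ≡ component (φs j) (suc a) x
    coefficient-singleton j a = ⊛-identityʳ (component-linear (φs j) (suc a))

    coefficient-++ : ∀ β γ x → (coefficient β ⊛ coefficient γ) x ≡ coefficient (β ++ γ) x
    coefficient-++ []            γ x = ⊛-identityˡ (coefficient-linear γ) x
    coefficient-++ ((j , a) ∷ β) γ x =
      trans (⊛-assoc (component-linear (φs j) (suc a)) (coefficient-linear β) (coefficient-linear γ) x)
            (⊛-congʳ (component (φs j) (suc a)) (coefficient-++ β γ) x)

    coefficient-𝟙 : ∀ α → coefficient α 𝟙 ≡ 𝟙Q α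
    coefficient-𝟙 []            = ε-unit
    coefficient-𝟙 ((j , a) ∷ α) = begin
      (component (φs j) (suc a) ⊛ coefficient α) 𝟙
        ≡⟨ ⊛-𝟙 (component-linear (φs j) (suc a)) (coefficient-linear α) ⟩
      component (φs j) (suc a) 𝟙 * coefficient α 𝟙
        ≡⟨ cong (_* coefficient α 𝟙) (component-𝟙 (φs j) a) ⟩
      0ℚ * coefficient α 𝟙
        ≡⟨ *-zeroˡ (coefficient α 𝟙) ⟩
      0ℚ ∎

    coefficient-character : ∀ j n x → Character.ch (φs j) (π n x) ≡ ζ j n (λ α → coefficient α (π n x))
    coefficient-character j zero    x = ch-π₀ (φs j) x
    coefficient-character j (suc n) x =
      sym (trans (coefficient-singleton j n (π (suc n) x)) (component-idem (φs j) (suc n) x))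

    singleton-productFormula : ∀ j a →
      ProductFormula (component (φs j) (suc a)) (unqsh ((j , a) ∷ [])) (coefficient ∘ proj₁) (coefficient ∘ proj₂)
    singleton-productFormula j a x y = begin
      χ (suc a) (x · y)
        ≡⟨ component-suc-· (φs j) a x y ⟩
      χ (suc a) x * ε y + (ε x * χ (suc a) y + (∑[ s ∈ splits a ] χ (suc (proj₁ s)) x * χ (suc (proj₂ s)) y))
        ≡⟨ sym (cong₂ _+_ (cong (_* ε y) (coefficient-singleton j a x))
                          (cong₂ _+_ (cong (ε x *_) (coefficient-singleton j a y)) splitTerms)) ⟩
      ∑ (((j , a) ∷ [] , []) ∷ ([] , (j , a) ∷ []) ∷ mergedSplits j a) F
        ≡⟨ cong (λ ps → ∑ ps F) (sym (unqsh-singleton j a)) ⟩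
      ∑ (unqsh ((j , a) ∷ [])) F ∎
      where
      χ : ℕ → H → ℚ
      χ = component (φs j)

      F : CComp m × CComp m → ℚ
      F p = coefficient (proj₁ p) x * coefficient (proj₂ p) y

      splitTerms : ∑ (mergedSplits j a) F
                 ≡ ∑[ s ∈ splits a ] χ (suc (proj₁ s)) x * χ (suc (proj₂ s)) y
      splitTerms = trans (∑-map (splits a) _ F) (∑-cong (splits a) (λ s →
        cong₂ _*_ (coefficient-singleton j (proj₁ s) x) (coefficient-singleton j (proj₂ s) y)))

    coefficient-· : ∀ γ → ProductFormula (coefficient γ) (unqsh γ) (coefficient ∘ proj₁) (coefficient ∘ proj₂)
    coefficient-· []            x y = trans (ε-mult x y) (sym (+-identityʳ _))
    coefficient-· ((j , a) ∷ γ) x y = begin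
      (component (φs j) (suc a) ⊛ coefficient γ) (x · y)
        ≡⟨ ⊛-productFormula {is = unqsh ((j , a) ∷ [])} {unqsh γ}
                            {coefficient ∘ proj₁} {coefficient ∘ proj₂} {coefficient ∘ proj₁} {coefficient ∘ proj₂}
                            (component-linear (φs j) (suc a)) (coefficient-linear γ)
                            (singleton-productFormula j a) (coefficient-· γ) x y ⟩
      ∑[ s ∈ unqsh ((j , a) ∷ []) ] ∑[ t ∈ unqsh γ ]
        (coefficient (proj₁ s) ⊛ coefficient (proj₁ t)) x * (coefficient (proj₂ s) ⊛ coefficient (proj₂ t)) y
        ≡⟨ ∑-cong (unqsh ((j , a) ∷ [])) (λ s → ∑-cong (unqsh γ) (λ t →
             cong₂ _*_ (coefficient-++ (proj₁ s) (proj₁ t) x) (coefficient-++ (proj₂ s) (proj₂ t) y))) ⟩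
      ∑[ s ∈ unqsh ((j , a) ∷ []) ] ∑[ t ∈ unqsh γ ] F (proj₁ s ++ proj₁ t , proj₂ s ++ proj₂ t)
        ≡⟨ ∑-comm (unqsh ((j , a) ∷ [])) (unqsh γ) _ ⟩
      ∑[ t ∈ unqsh γ ] ∑[ s ∈ unqsh ((j , a) ∷ []) ] F (proj₁ s ++ proj₁ t , proj₂ s ++ proj₂ t)
        ≡⟨ sym (∑-unqsh-∷ (j , a) γ F) ⟩
      ∑ (unqsh ((j , a) ∷ γ)) F ∎
      where
      F : CComp m × CComp m → ℚ
      F p = coefficient (proj₁ p) x * coefficient (proj₂ p) y

    universalMorphism : Morphism m 𝓗 φs
    universalMorphism = record
      { Ψ        = λ x α → coefficient α x
      ; Ψ-cong   = λ e α → resp-≈ (coefficient-linear α) e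
      ; Ψ-add    = λ x y α → +ᴹ-homo (coefficient-linear α) x y
      ; Ψ-scale  = λ r x α → *ₗ-homo (coefficient-linear α) r x
      ; Ψ-graded = λ n x α → coefficient-homogeneous α n x
      ; Ψ-mult   = λ x y α → coefficient-· α x y
      ; Ψ-unit   = coefficient-𝟙
      ; Ψ-comult = λ h β γ → coefficient-++ β γ h
      ; Ψ-counit = λ h → refl
      ; Ψ-char   = coefficient-character
      }

    module _ (M : Morphism m 𝓗 φs) where
      open Morphism M

      morphism-linear : ∀ α → IsLinear (λ x → Ψ x α)
      morphism-linear α = record
        { resp-≈ = λ e → Ψ-cong e α ; +ᴹ-homo = λ x y → Ψ-add x y α ; *ₗ-homo = λ r x → Ψ-scale r x α }

      morphism-singleton : ∀ j a x → Ψ x ((j , a) ∷ []) ≡ component (φs j) (suc a) x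
      morphism-singleton j a = linear-ext (morphism-linear ((j , a) ∷ [])) (component-linear (φs j) (suc a)) on-π
        where
        on-π : ∀ n x → Ψ (π n x) ((j , a) ∷ []) ≡ component (φs j) (suc a) (π n x)
        on-π n x with n ℕ.≟ suc a
        ... | yes refl = trans (sym (Ψ-char j (suc a) x)) (sym (component-idem (φs j) (suc a) x))
        ... | no n≢1+a = trans (Ψ-graded n x ((j , a) ∷ []) size≢n)
                               (sym (component-homogeneous (φs j) (suc a) n x (n≢1+a ∘ sym)))
          where
          size≢n : suc a ℕ.+ 0 ≢ n
          size≢n 1+a+0≡n = n≢1+a (trans (sym 1+a+0≡n) (ℕ.+-identityʳ (suc a)))

      morphism-coefficient : ∀ α h → Ψ h α ≡ coefficient α h
      morphism-coefficient []            h = Ψ-counit h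
      morphism-coefficient ((j , a) ∷ α) h = begin
        Ψ h ((j , a) ∷ α)
          ≡⟨ sym (Ψ-comult h ((j , a) ∷ []) α) ⟩
        ∑[ t ∈ Δ h ] proj₁ t * (Ψ (left t) ((j , a) ∷ []) * Ψ (right t) α)
          ≡⟨ ∑-cong (Δ h) (λ t → cong (proj₁ t *_)
               (cong₂ _*_ (morphism-singleton j a (left t)) (morphism-coefficient α (right t)))) ⟩
        (component (φs j) (suc a) ⊛ coefficient α) h ∎

    iterΔ-coefficient : ∀ p α h →
      ∑[ t ∈ iterΔ 𝓗 φs (length α) h ] proj₁ t * prodΦ 𝓗 φs (p ∷ α) (proj₂ t) ≡ coefficient (p ∷ α) h
    iterΔ-coefficient (j , a) [] h = begin
      1ℚ * (χ h * 1ℚ) + 0ℚ   ≡⟨ trans (+-identityʳ _) (trans (*-identityˡ _) (*-identityʳ _)) ⟩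
      χ h                     ≡⟨ sym (coefficient-singleton j a h) ⟩
      coefficient ((j , a) ∷ []) h ∎
      where
      χ : H → ℚ
      χ = component (φs j) (suc a)
    iterΔ-coefficient (j , a) (p ∷ α) h = begin
      ∑ (concatMap (λ t → map (λ t′ → (proj₁ t * proj₁ t′ , left t ∷ proj₂ t′)) (rest t)) (Δ h))
        (λ t → proj₁ t * prodΦ 𝓗 φs ((j , a) ∷ p ∷ α) (proj₂ t))
        ≡⟨ ∑-concatMap-map (Δ h) rest _ _ ⟩
      ∑[ t ∈ Δ h ] ∑[ t′ ∈ rest t ] (proj₁ t * proj₁ t′) * (χ (left t) * P (proj₂ t′))
        ≡⟨ ∑-cong (Δ h) (λ t → sym (factor (proj₁ t) (χ (left t)) (rest t))) ⟩
      ∑[ t ∈ Δ h ] proj₁ t * (χ (left t) * (∑[ t′ ∈ rest t ] proj₁ t′ * P (proj₂ t′)))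
        ≡⟨ ∑-cong (Δ h) (λ t → cong (λ z → proj₁ t * (χ (left t) * z)) (iterΔ-coefficient p α (right t))) ⟩
      coefficient ((j , a) ∷ p ∷ α) h ∎
      where
      χ : H → ℚ
      χ = component (φs j) (suc a)

      P : Vec H (length (p ∷ α)) → ℚ
      P = prodΦ 𝓗 φs (p ∷ α)

      rest : ℚ × Vec H 2 → Tensor V (length (p ∷ α))
      rest t = iterΔ 𝓗 φs (length α) (right t)

      factor : ∀ q c ts → q * (c * (∑[ t′ ∈ ts ] proj₁ t′ * P (proj₂ t′)))
                        ≡ ∑[ t′ ∈ ts ] (q * proj₁ t′) * (c * P (proj₂ t′))
      factor q c ts = begin
        q * (c * (∑[ t′ ∈ ts ] proj₁ t′ * P (proj₂ t′)))
          ≡⟨ cong (q *_) (*-distribˡ-∑ c ts _) ⟩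
        q * (∑[ t′ ∈ ts ] c * (proj₁ t′ * P (proj₂ t′)))
          ≡⟨ *-distribˡ-∑ q ts _ ⟩
        ∑[ t′ ∈ ts ] q * (c * (proj₁ t′ * P (proj₂ t′)))
          ≡⟨ ∑-cong ts (λ t′ → regroup q c (proj₁ t′) (P (proj₂ t′))) ⟩
        ∑[ t′ ∈ ts ] (q * proj₁ t′) * (c * P (proj₂ t′)) ∎
        where
        regroup : ∀ q c p x → q * (c * (p * x)) ≡ (q * p) * (c * x)
        regroup = solve-∀ ℚ-ring

    φ-coefficient : ∀ α h → φ_ 𝓗 φs α h ≡ coefficient α h
    φ-coefficient []      h = refl
    φ-coefficient (p ∷ α) h = iterΔ-coefficient p α h

    coefficient-formula : ∀ n h α → coefficient α (π n h) ≡ ΨFormula 𝓗 φs n (π n h) α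
    coefficient-formula n h α = by-degree (size α ℕ.≟ n)
      where
      select : Bool → ℚ
      select b = if b then φ_ 𝓗 φs α (π n h) else 0ℚ

      by-degree : Dec (size α ≡ n) → coefficient α (π n h) ≡ select (does (size α ℕ.≟ n))
      by-degree (yes size≡n) =
        trans (sym (φ-coefficient α (π n h))) (cong select (sym (dec-true (size α ℕ.≟ n) size≡n)))
      by-degree (no size≢n)  =
        trans (coefficient-homogeneous α n h size≢n) (cong select (sym (dec-false (size α ℕ.≟ n) size≢n)))

mainTheorem19 : ∀ {c ℓ} (m : ℕ) → 1 ≤ m → (𝓗 : GCHopf c ℓ) → (φ : Fin m → Character 𝓗) →
    Σ (Morphism m 𝓗 φ) (λ Ψ →
      (∀ n h α → Morphism.Ψ Ψ (GCHopf.π 𝓗 n h) α ≡ ΨFormula 𝓗 φ n (GCHopf.π 𝓗 n h) α)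
      × (∀ (Ψ' : Morphism m 𝓗 φ) h α → Morphism.Ψ Ψ' h α ≡ Morphism.Ψ Ψ h α))
mainTheorem19 m _ 𝓗 φ =
  universalMorphism 𝓗 φ , coefficient-formula 𝓗 φ , λ Ψ′ h α → morphism-coefficient 𝓗 φ Ψ′ α h
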